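{- Let $M,N\in\mathcal{M}$, $\alpha$ a countable ordinal and $n\in\mathbb{N}$. If $M\equiv_\alpha N$ and $N\twoheadrightarrow_h\mathsf{x}_n$, then $M\twoheadrightarrow_h\mathsf{x}_n$.
   Context: Addressing machines. Fix a countable set $\mathbb{A}$ of addresses and a symbol $\varnothing\notin\mathbb{A}$; put $\mathbb{A}_\varnothing=\mathbb{A}\cup\{\varnothing\}$. A tape is a finite list of elements of $\mathbb{A}$; $a::T$ has head $a$ and tail $T$, $T@T'$ is concatenation. A program is a finite list of instructions generated by $P::=\mathtt{Load}\ i;P\mid A$, $A::=\mathtt{App}(i,j,k);A\mid C$, $C::=\mathtt{Call}\ i\mid\varepsilon$ ($i,j,k\in\mathbb{N}$). For $r\in\mathbb{N}$, $I\subseteq\{0,\dots,r-1\}$, $I\models^r P$ is the least relation such that: $I\models^r\varepsilon$; $I\models^r\mathtt{Call}\ i$ if $i\in I$; $I\models^r\mathtt{App}(i,j,k);A$ if $i,j\in I$ and either ($k<r$ and $I\cup\{k\}\models^r A$) or ($k\ge r$ and $I\models^r A$); $I\models^r\mathtt{Load}\ i;P$ if either ($i<r$ and $I\cup\{i\}\models^r P$) or ($i\ge r$ and $I\models^r P$). An addressing machine is $M=\langle R_0,\dots,R_{r-1},P,T\rangle$ with registers in $\mathbb{A}_\varnothing$, $P$ valid w.r.t. the registers ($\{i<r\mid R_i\ne\varnothing\}\models^r P$), and a tape $T$; $\mathcal{M}$ is the set of all of them, components $M.\vec R,M.P,M.T$. $\vec R[R_i:=a]$ replaces $R_i$ by $a$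 if $i<r$, is $\vec R$ if $i\ge r$; for a machine $M$, $M[R_i:=a]$ is $M$ with registers $M.\vec R[R_i:=a]$. $M$ is stuck if $M.P=\mathtt{Load}\ i;P'$ and $M.T=[]$. Fix a bijection $\#:\mathcal{M}\to\mathbb{A}$ with inverse $\#^{ -1}$; $M@T'=\langle M.\vec R,M.P,M.T@T'\rangle$; $a\cdot b=\#(\#^{ -1}(a)@[b])$. Head reduction: $\langle\vec R,\mathtt{Load}\ i;P,a::T\rangle\to_h\langle\vec R[R_i:=a],P,T\rangle$, $\langle\vec R,\mathtt{App}(i,j,k);P,T\rangle\to_h\langle\vec R[R_k:=R_i\cdot R_j],P,T\rangle$, $\langle\vec R,\mathtt{Call}\ i,T\rangle\to_h\#^{ -1}(R_i)@T$; $\twoheadrightarrow_h$ reflexive-transitive closure; "$M\twoheadrightarrow_h\mathrm{stuck}$" means $M\twoheadrightarrow_h N$ for some stuck $N$. For $n\in\mathbb{N}$, the indeterminate machine $\mathsf{x}_n=\langle\varnothing,\dots,\varnothing,\varepsilon,[]\rangle$ has $n+1$ empty registers, empty program and empty tape. Induced relations: for a relation $\equiv_R$ on $\mathcal{M}$, $a\simeq_R b$ iff $\#^{ -1}(a)\equiv_R\#^{ -1}(b)$; on $\mathbb{A}_\varnothing$, both $\varnothing$ or both addresses related; componentwise on tuples/tapes of equal length; $M=_R N$ iff $M.\vec R\simeq_R N.\vec R$, $M.P=N.P$, $M.T\simeq_R N.T$. $\equiv_{\mathbb{A}}$ is the least equivalence relation on $\mathcal{M}$ such that $M\twoheadrightarrow_h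 Z=_{\mathbb{A}}N$ implies $M\equiv_{\mathbb{A}}N$. Ordinal-indexed relations: for each countable ordinal $\alpha$, relations $\equiv_\alpha,\sim_\alpha,\approx_\alpha$ on $\mathcal{M}$ are (simultaneously) the least reflexive and symmetric relations closed under: if $M\equiv_{\mathbb{A}}N$ then $M\approx_0N$; $M\approx_\alpha N\Rightarrow M\sim_\alpha N$; $M\sim_\alpha N\Rightarrow M\equiv_\alpha N$; if $M\twoheadrightarrow_h\mathrm{stuck}$, $N\twoheadrightarrow_h\mathrm{stuck}$ and for every $a\in\mathbb{A}$ there is $\gamma<\alpha$ with $M@[a]\equiv_\gamma N@[a]$, then $M\approx_\alpha N$; if $\#^{ -1}(a)\sim_\alpha\#^{ -1}(b)$ then $M[R_i:=a]\sim_\alpha M[R_i:=b]$ and $M@[a]\sim_\alpha M@[b]$; if $M\sim_\alpha N$ then $M@T\sim_\alpha N@T$ for every tape $T$; the same three closure rules with $\equiv_\alpha$ in place of $\sim_\alpha$; for $\gamma\le\alpha$, $M\approx_\gamma N\Rightarrow M\approx_\alpha N$, $M\sim_\gamma N\Rightarrow M\sim_\alpha N$, $M\equiv_\gamma N\Rightarrow M\equiv_\alpha N$; and $M\equiv_\alpha Z$, $Z\equiv_\alpha N$ imply $M\equiv_\alpha N$. -}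

module Defs where

open import Data.Nat using (ℕ; zero; suc; _<ᵇ_; _≡ᵇ_)
open import Data.Bool using (Bool; true; false; _∨_; if_then_else_; T)
open import Data.Maybe using (Maybe; just; nothing; is-just)
open import Data.List using (List; []; _∷_; _++_; length; replicate; [_])
open import Data.List.Relation.Binary.Pointwise using (Pointwise)
open import Data.Product using (Σ; _×_; _,_; proj₁; proj₂; ∃; ∃₂)
open import Data.Unit using (⊤; tt)
open import Data.Empty using (⊥)
open import Function using (_∘_)
open import Function.Bundles using (_↔_; Inverse)
open import Relation.Binary.PropositionalEquality using (_≡_; refl; subst; sym; cong)
open import Relation.Binary.Construct.Closure.ReflexiveTransitive using (Star)

-- Countable ordinals, represented as Brouwer trees
-- (zero, successor, limit of an ℕ-indexed sequence), with the
-- usual (Tait-style) strict and non-strict orderings.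

data Ord : Set where
  ozero : Ord
  osuc  : Ord → Ord
  olim  : (ℕ → Ord) → Ord

mutual
  _≤ₒ_ : Ord → Ord → Set
  ozero  ≤ₒ y = ⊤
  osuc x ≤ₒ y = x <ₒ y
  olim f ≤ₒ y = ∀ n → f n ≤ₒ y

  _<ₒ_ : Ord → Ord → Set
  x <ₒ ozero  = ⊥
  x <ₒ osuc y = x ≤ₒ y
  x <ₒ olim f = Σ ℕ λ n → x <ₒ f n

data CProg : Set where
  call : ℕ → CProg
  ε    : CProg

data AProg : Set where
  app  : ℕ → ℕ → ℕ → AProg → AProg
  cprg : CProg → AProg

data Prog : Set where
  load : ℕ → Prog → Prog
  aprg : AProg → Prog

-- Subsets I ⊆ {0,…,r-1} are represented by characteristic functions.
Subset : Set
Subset = ℕ → Bool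

_⊆_ : Subset → Subset → Set
I ⊆ J = ∀ i → T (I i) → T (J i)

ins : ℕ → Subset → Subset
ins k I j = (j ≡ᵇ k) ∨ I j

insR : ℕ → ℕ → Subset → Subset
insR r k I = if k <ᵇ r then ins k I else I

-- the validity relation  I ⊨^r P  (its clauses are deterministic,
-- so it is defined by recursion on the program)
⊨C : ℕ → Subset → CProg → Set
⊨C r I (call i) = T (I i)
⊨C r I ε        = ⊤

⊨A : ℕ → Subset → AProg → Set
⊨A r I (app i j k A) = T (I i) × T (I j) × ⊨A r (insR r k I) A
⊨A r I (cprg C)      = ⊨C r I C

⊨P : ℕ → Subset → Prog → Set
⊨P r I (load i P) = ⊨P r (insR r i I) P
⊨P r I (aprg A)   = ⊨A r I A

-- Registers: a list of length r of elements of 𝔸_∅ = Maybe 𝔸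
-- (nothing plays the role of ∅).

module _ {A : Set} where

  occ : List (Maybe A) → Subset
  occ []       i       = false
  occ (x ∷ R)  zero    = is-just x
  occ (x ∷ R)  (suc i) = occ R i

  get : (R : List (Maybe A)) (i : ℕ) → T (occ R i) → A
  get []            i       ()
  get (just a ∷ R)  zero    p = a
  get (nothing ∷ R) zero    ()
  get (x ∷ R)       (suc i) p = get R i p

  upd : List (Maybe A) → ℕ → Maybe A → List (Maybe A)
  upd []      i       x = []
  upd (_ ∷ R) zero    x = x ∷ R
  upd (y ∷ R) (suc i) x = y ∷ upd R i x

  length-upd : ∀ R i x → length (upd R i x) ≡ length R
  length-upd []      i       x = refl
  length-upd (_ ∷ R) zero    x = refl
  length-upd (y ∷ R) (suc i) x = cong suc (length-upd R i x)

private
  ∨-inj₂ : ∀ a {b} → T b → T (a ∨ b)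
  ∨-inj₂ true  _ = tt
  ∨-inj₂ false p = p

  ∨-elim : ∀ {X : Set} a {b} → T (a ∨ b) → (T a → X) → (T b → X) → X
  ∨-elim true  p f g = f tt
  ∨-elim false p f g = g p

  ins-mono : ∀ k {I J} → I ⊆ J → ins k I ⊆ ins k J
  ins-mono k s j p = ∨-elim (j ≡ᵇ k) p (λ q → subst T (sym (∨true (j ≡ᵇ k) q)) tt)
                                         (λ q → ∨-inj₂ (j ≡ᵇ k) (s j q))
    where
    ∨true : ∀ a {b} → T a → (a ∨ b) ≡ true
    ∨true true _ = refl

  insR-mono : ∀ r k {I J} → I ⊆ J → insR r k I ⊆ insR r k J
  insR-mono r k s with k <ᵇ r
  ... | true  = ins-mono k s
  ... | false = s

mono-C : ∀ r {I J} → I ⊆ J → ∀ C → ⊨C r I C → ⊨C r J C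
mono-C r s (call i) v = s i v
mono-C r s ε        v = tt

mono-A : ∀ r {I J} → I ⊆ J → ∀ A → ⊨A r I A → ⊨A r J A
mono-A r s (app i j k A) (p , q , v) = s i p , s j q , mono-A r (insR-mono r k s) A v
mono-A r s (cprg C)      v           = mono-C r s C v

mono-P : ∀ r {I J} → I ⊆ J → ∀ P → ⊨P r I P → ⊨P r J P
mono-P r s (load i P) v = mono-P r (insR-mono r i s) P v
mono-P r s (aprg A)   v = mono-A r s A v

module _ {A : Set} where

  upd-occ : ∀ (R : List (Maybe A)) i a → insR (length R) i (occ R) ⊆ occ (upd R i (just a))
  upd-occ []      i       a j p = p
  upd-occ (x ∷ R) zero    a zero    p = tt
  upd-occ (x ∷ R) zero    a (suc j) p = p
  upd-occ (x ∷ R) (suc i) a zero    p with i <ᵇ length R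
  ... | true  = p
  ... | false = p
  upd-occ (x ∷ R) (suc i) a (suc j) p with i <ᵇ length R in eq
  ... | true  = upd-occ R i a j (subst (λ b → T ((if b then ins i (occ R) else occ R) j)) (sym eq) p)
  ... | false = upd-occ R i a j (subst (λ b → T ((if b then ins i (occ R) else occ R) j)) (sym eq) p)

  upd-occ' : ∀ (R : List (Maybe A)) i a → occ R ⊆ occ (upd R i (just a))
  upd-occ' R i a j p = upd-occ R i a j (helper (i <ᵇ length R))
    where
    helper : ∀ b → T ((if b then ins i (occ R) else occ R) j)
    helper true  = ∨-inj₂ (j ≡ᵇ i) p
    helper false = p

  valid-upd : ∀ (R : List (Maybe A)) i a P →
              ⊨P (length R) (insR (length R) i (occ R)) P →
              ⊨P (length (upd R i (just a))) (occ (upd R i (just a))) P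
  valid-upd R i a P v =
    subst (λ r → ⊨P r (occ (upd R i (just a))) P) (sym (length-upd R i (just a)))
          (mono-P (length R) (upd-occ R i a) P v)

  valid-updA : ∀ (R : List (Maybe A)) i a B →
              ⊨A (length R) (insR (length R) i (occ R)) B →
              ⊨A (length (upd R i (just a))) (occ (upd R i (just a))) B
  valid-updA R i a B v = valid-upd R i a (aprg B) v

  valid-upd' : ∀ (R : List (Maybe A)) i a P →
              ⊨P (length R) (occ R) P →
              ⊨P (length (upd R i (just a))) (occ (upd R i (just a))) P
  valid-upd' R i a P v =
    subst (λ r → ⊨P r (occ (upd R i (just a))) P) (sym (length-upd R i (just a)))
          (mono-P (length R) (upd-occ' R i a) P v)

-- Addressing machines ⟨R_0,…,R_{r-1}, P, T⟩ over the address set A,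
-- with r = length of the register list and P valid w.r.t. the registers.

record Machine (A : Set) : Set where
  constructor mk
  field
    Regs  : List (Maybe A)
    Prg   : Prog
    valid : ⊨P (length Regs) (occ Regs) Prg
    Tape  : List A

open Machine public

module _ {A : Set} where

  _++ₘ_ : Machine A → List A → Machine A
  mk R P v T ++ₘ T' = mk R P v (T ++ T')

  _[_≔_] : Machine A → ℕ → A → Machine A
  mk R P v T [ i ≔ a ] = mk (upd R i (just a)) P (valid-upd' R i a P v) T

  Stuck : Machine A → Set
  Stuck M = ∃₂ λ i P' → Prg M ≡ load i P' × Tape M ≡ []

  x : ℕ → Machine A
  x n = mk (replicate (suc n) nothing) (aprg (cprg ε)) tt []

-- Everything below depends on the fixed bijection # : ℳ → 𝔸
-- given as  enc : Machine A ↔ A  (to = #, from = #⁻¹).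

module _ {A : Set} (enc : Machine A ↔ A) where

  private
    # : Machine A → A
    # = Inverse.to enc
    #⁻¹ : A → Machine A
    #⁻¹ = Inverse.from enc

  _·_ : A → A → A
  a · b = # (#⁻¹ a ++ₘ [ b ])

  data _→h_ : Machine A → Machine A → Set where
    h-load : ∀ R i P v a T →
      mk R (load i P) v (a ∷ T) →h mk (upd R i (just a)) P (valid-upd R i a P v) T
    h-app : ∀ R i j k B (v : ⊨A (length R) (occ R) (app i j k B)) T →
      mk R (aprg (app i j k B)) v T →h
      mk (upd R k (just (get R i (proj₁ v) · get R j (proj₁ (proj₂ v)))))
         (aprg B)
         (valid-updA R k (get R i (proj₁ v) · get R j (proj₁ (proj₂ v))) B (proj₂ (proj₂ v)))
         T
    h-call : ∀ R i v T →
      mk R (aprg (cprg (call i))) v T →h (#⁻¹ (get R i v) ++ₘ T)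

  _↠h_ : Machine A → Machine A → Set
  _↠h_ = Star _→h_

  ↠stuck : Machine A → Set
  ↠stuck M = ∃ λ N → M ↠h N × Stuck N

  data Rel∅ (E : Machine A → Machine A → Set) : Maybe A → Maybe A → Set where
    ∅∅ : Rel∅ E nothing nothing
    aa : ∀ {a b} → E (#⁻¹ a) (#⁻¹ b) → Rel∅ E (just a) (just b)

  record _=[_]_ (M : Machine A) (E : Machine A → Machine A → Set) (N : Machine A) : Set where
    inductive
    constructor eqR
    field
      regs : Pointwise (Rel∅ E) (Regs M) (Regs N)
      prog : Prg M ≡ Prg N
      tape : Pointwise (λ a b → E (#⁻¹ a) (#⁻¹ b)) (Tape M) (Tape N)

  data _≡𝔸_ : Machine A → Machine A → Set where
    𝔸-base  : ∀ {M Z N} → M ↠h Z → Z =[ _≡𝔸_ ] N → M ≡𝔸 N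
    𝔸-refl  : ∀ {M} → M ≡𝔸 M
    𝔸-sym   : ∀ {M N} → M ≡𝔸 N → N ≡𝔸 M
    𝔸-trans : ∀ {M Z N} → M ≡𝔸 Z → Z ≡𝔸 N → M ≡𝔸 N

  mutual
    data _≈[_]_ : Machine A → Ord → Machine A → Set where
      ≈-refl  : ∀ {α M} → M ≈[ α ] M
      ≈-sym   : ∀ {α M N} → M ≈[ α ] N → N ≈[ α ] M
      ≈-𝔸     : ∀ {M N} → M ≡𝔸 N → M ≈[ ozero ] N
      ≈-stuck : ∀ {α M N} → ↠stuck M → ↠stuck N →
                (∀ a → Σ Ord λ γ → γ <ₒ α × ((M ++ₘ [ a ]) ≡[ γ ] (N ++ₘ [ a ]))) →
                M ≈[ α ] N
      ≈-mono  : ∀ {γ α M N} → γ ≤ₒ α → M ≈[ γ ] N → M ≈[ α ] N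

    data _∼[_]_ : Machine A → Ord → Machine A → Set where
      ∼-refl  : ∀ {α M} → M ∼[ α ] M
      ∼-sym   : ∀ {α M N} → M ∼[ α ] N → N ∼[ α ] M
      ∼-≈     : ∀ {α M N} → M ≈[ α ] N → M ∼[ α ] N
      ∼-reg   : ∀ {α a b} M i → #⁻¹ a ∼[ α ] #⁻¹ b → (M [ i ≔ a ]) ∼[ α ] (M [ i ≔ b ])
      ∼-arg   : ∀ {α a b} M → #⁻¹ a ∼[ α ] #⁻¹ b → (M ++ₘ [ a ]) ∼[ α ] (M ++ₘ [ b ])
      ∼-tape  : ∀ {α M N} (T' : List A) → M ∼[ α ] N → (M ++ₘ T') ∼[ α ] (N ++ₘ T')
      ∼-mono  : ∀ {γ α M N} → γ ≤ₒ α → M ∼[ γ ] N → M ∼[ α ] N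

    data _≡[_]_ : Machine A → Ord → Machine A → Set where
      ≡-refl  : ∀ {α M} → M ≡[ α ] M
      ≡-sym   : ∀ {α M N} → M ≡[ α ] N → N ≡[ α ] M
      ≡-∼     : ∀ {α M N} → M ∼[ α ] N → M ≡[ α ] N
      ≡-reg   : ∀ {α a b} M i → #⁻¹ a ≡[ α ] #⁻¹ b → (M [ i ≔ a ]) ≡[ α ] (M [ i ≔ b ])
      ≡-arg   : ∀ {α a b} M → #⁻¹ a ≡[ α ] #⁻¹ b → (M ++ₘ [ a ]) ≡[ α ] (M ++ₘ [ b ])
      ≡-tape  : ∀ {α M N} (T' : List A) → M ≡[ α ] N → (M ++ₘ T') ≡[ α ] (N ++ₘ T')
      ≡-mono  : ∀ {γ α M N} → γ ≤ₒ α → M ≡[ γ ] N → M ≡[ α ] N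
      ≡-trans : ∀ {α M Z N} → M ≡[ α ] Z → Z ≡[ α ] N → M ≡[ α ] N

-- Call K and L observationally equivalent, K ≃ L, when for every tape T and every n,
-- K @ T ↠h x n iff L @ T ↠h x n. Every rule generating ≡_𝔸, ≈_α, ∼_α and ≡_α preserves
-- ≃, so all these relations are contained in it whatever α is, and the theorem is the
-- case T = []. Head reduction is deterministic and x n is normal, so reduction preserves
-- ≃ and a machine reducing to a stuck one never reaches x n; this is why the extensional
-- rule only has to be checked on nonempty tapes. The real work is the congruence rule:
-- machines whose registers and tapes are componentwise ≃ are ≃. It is proved by
-- simulating a reduction of one machine by the other, by induction on its length; since
-- App and Call build new machines M @ [b] from related M and b, the simulation relation
-- must be closed under appending related tapes.
module Submission where

open import Defs
open import Data.Nat using (ℕ; zero; suc)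
open import Data.List using ([]; _∷_; _++_; replicate; [_])
open import Data.List.Properties using (++-assoc; ++-identityʳ)
open import Data.List.Relation.Binary.Pointwise as Pointwise using (Pointwise; []; _∷_; ++⁺)
open import Data.Maybe using (just; nothing)
open import Data.Product using (∃; _×_; _,_; proj₁; proj₂)
open import Data.Empty using (⊥-elim)
open import Function.Base using (_on_)
open import Function.Bundles using (_↔_; Inverse)
open import Relation.Nullary using (¬_)
open import Relation.Binary.PropositionalEquality using (_≡_; refl; sym; cong; subst; subst₂)
open import Relation.Binary.Construct.Closure.ReflexiveTransitive using (_◅_; _◅◅_)
  renaming (ε to done)

module _ {A : Set} where

  ++ₘ-assoc : ∀ (M : Machine A) T T′ → (M ++ₘ T) ++ₘ T′ ≡ M ++ₘ (T ++ T′)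
  ++ₘ-assoc (mk R P v T₀) T T′ = cong (mk R P v) (++-assoc T₀ T T′)

  ++ₘ-identityʳ : ∀ (M : Machine A) → M ++ₘ [] ≡ M
  ++ₘ-identityʳ (mk R P v T) = cong (mk R P v) (++-identityʳ T)

module _ {A : Set} (enc : Machine A ↔ A) where

  private
    #⁻¹ : A → Machine A
    #⁻¹ = Inverse.from enc

    _⟶_ : Machine A → Machine A → Set
    _⟶_ = _→h_ enc

    _↠_ : Machine A → Machine A → Set
    _↠_ = _↠h_ enc

    _=⟨_⟩_ : Machine A → (Machine A → Machine A → Set) → Machine A → Set
    K =⟨ E ⟩ L = _=[_]_ enc K E L

  ⟶-deterministic : ∀ {M N N′} → M ⟶ N → M ⟶ N′ → N ≡ N′
  ⟶-deterministic (h-load _ _ _ _ _ _) (h-load _ _ _ _ _ _) = refl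
  ⟶-deterministic (h-app _ _ _ _ _ _ _) (h-app _ _ _ _ _ _ _) = refl
  ⟶-deterministic (h-call _ _ _ _) (h-call _ _ _ _) = refl

  ⟶-++ₘ : ∀ {M N} T′ → M ⟶ N → (M ++ₘ T′) ⟶ (N ++ₘ T′)
  ⟶-++ₘ T′ (h-load R i P v a T) = h-load R i P v a (T ++ T′)
  ⟶-++ₘ T′ (h-app R i j k B v T) = h-app R i j k B v (T ++ T′)
  ⟶-++ₘ T′ (h-call R i v T) =
    subst (mk R (aprg (cprg (call i))) v (T ++ T′) ⟶_)
          (sym (++ₘ-assoc (#⁻¹ (get R i v)) T T′)) (h-call R i v (T ++ T′))

  ↠-++ₘ : ∀ {M N} T → M ↠ N → (M ++ₘ T) ↠ (N ++ₘ T)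
  ↠-++ₘ T done = done
  ↠-++ₘ T (s ◅ r) = ⟶-++ₘ T s ◅ ↠-++ₘ T r

  x-normal : ∀ {n M} → ¬ (x n ⟶ M)
  x-normal ()

  Stuck-normal : ∀ {S M} → Stuck S → ¬ (S ⟶ M)
  Stuck-normal (_ , _ , () , _) (h-app _ _ _ _ _ _ _)
  Stuck-normal (_ , _ , () , _) (h-call _ _ _ _)
  Stuck-normal (_ , _ , _ , ()) (h-load _ _ _ _ _ _)

  reduct-↠x : ∀ {n M Y} → M ↠ Y → M ↠ x n → Y ↠ x n
  reduct-↠x done r = r
  reduct-↠x (s ◅ q) done = ⊥-elim (x-normal s)
  reduct-↠x (s ◅ q) (s′ ◅ r) = reduct-↠x q (subst (_↠ _) (⟶-deterministic s′ s) r)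

  ↠stuck⇒¬↠x : ∀ {n M} → ↠stuck enc M → ¬ (M ↠ x n)
  ↠stuck⇒¬↠x (S , M↠S , stuck) M↠x with reduct-↠x M↠S M↠x | stuck
  ... | done    | (_ , _ , () , _)
  ... | s ◅ _   | _ = Stuck-normal stuck s

  _≼_ : Machine A → Machine A → Set
  K ≼ L = ∀ T n → (L ++ₘ T) ↠ x n → (K ++ₘ T) ↠ x n

  _≃_ : Machine A → Machine A → Set
  K ≃ L = K ≼ L × L ≼ K

  ≼⇒↠x : ∀ {K L n} → K ≼ L → L ↠ x n → K ↠ x n
  ≼⇒↠x {K} {L} {n} K≼L L↠x =
    subst (_↠ x n) (++ₘ-identityʳ K) (K≼L [] n (subst (_↠ x n) (sym (++ₘ-identityʳ L)) L↠x))

  ≃-refl : ∀ {K} → K ≃ K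
  ≃-refl = (λ T n r → r) , (λ T n r → r)

  ≃-sym : ∀ {K L} → K ≃ L → L ≃ K
  ≃-sym (p , q) = q , p

  ≃-trans : ∀ {K L N} → K ≃ L → L ≃ N → K ≃ N
  ≃-trans (p , q) (p′ , q′) = (λ T n r → p T n (p′ T n r)) , (λ T n r → q′ T n (q T n r))

  ↠⇒≃ : ∀ {M Z} → M ↠ Z → M ≃ Z
  ↠⇒≃ M↠Z = (λ T n r → ↠-++ₘ T M↠Z ◅◅ r) , (λ T n r → reduct-↠x (↠-++ₘ T M↠Z) r)

  ≃-++ₘ : ∀ {M N} T′ → M ≃ N → (M ++ₘ T′) ≃ (N ++ₘ T′)
  ≃-++ₘ T′ (p , q) = shift p , shift q
    where
    shift : ∀ {K L} → K ≼ L → (K ++ₘ T′) ≼ (L ++ₘ T′)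
    shift {K} {L} K≼L T n r =
      subst (_↠ x n) (sym (++ₘ-assoc K T′ T))
            (K≼L (T′ ++ T) n (subst (_↠ x n) (++ₘ-assoc L T′ T) r))

  ≼-stuck : ∀ {M N} → ↠stuck enc N → (∀ a → (M ++ₘ [ a ]) ≼ (N ++ₘ [ a ])) → M ≼ N
  ≼-stuck {N = N} N↠stuck f [] n r =
    ⊥-elim (↠stuck⇒¬↠x N↠stuck (subst (_↠ x n) (++ₘ-identityʳ N) r))
  ≼-stuck {M} {N} N↠stuck f (a ∷ T) n r =
    subst (_↠ x n) (++ₘ-assoc M [ a ] T) (f a T n (subst (_↠ x n) (sym (++ₘ-assoc N [ a ] T)) r))

  ≃-stuck : ∀ {M N} → ↠stuck enc M → ↠stuck enc N →
            (∀ a → (M ++ₘ [ a ]) ≃ (N ++ₘ [ a ])) → M ≃ N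
  ≃-stuck M↠stuck N↠stuck f =
    ≼-stuck N↠stuck (λ a → proj₁ (f a)) , ≼-stuck M↠stuck (λ a → proj₂ (f a))

  module _ {E F : Machine A → Machine A → Set} where

    Rel∅-map : (∀ {K L} → E K L → F K L) → ∀ {u u′} → Rel∅ enc E u u′ → Rel∅ enc F u u′
    Rel∅-map f ∅∅ = ∅∅
    Rel∅-map f (aa e) = aa (f e)

    Rel∅-sym : (∀ {K L} → E K L → F L K) → ∀ {u u′} → Rel∅ enc E u u′ → Rel∅ enc F u′ u
    Rel∅-sym f ∅∅ = ∅∅
    Rel∅-sym f (aa e) = aa (f e)

    componentwise-map : (∀ {K L} → E K L → F K L) → ∀ {K L} → K =⟨ E ⟩ L → K =⟨ F ⟩ L
    componentwise-map f (eqR regs prog tape) =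
      eqR (Pointwise.map (Rel∅-map f) regs) prog (Pointwise.map f tape)

    componentwise-sym : (∀ {K L} → E K L → F L K) → ∀ {K L} → K =⟨ E ⟩ L → L =⟨ F ⟩ K
    componentwise-sym f (eqR regs prog tape) =
      eqR (Pointwise.symmetric (Rel∅-sym f) regs) (sym prog) (Pointwise.symmetric f tape)

  module _ {E : Machine A → Machine A → Set} where

    Rel∅-refl : (∀ {K} → E K K) → ∀ {u} → Rel∅ enc E u u
    Rel∅-refl e {nothing} = ∅∅
    Rel∅-refl e {just a} = aa e

    componentwise-++ₘ : (∀ {K} → E K K) → ∀ (M : Machine A) {T T′} →
                        Pointwise (E on #⁻¹) T T′ → (M ++ₘ T) =⟨ E ⟩ (M ++ₘ T′)
    componentwise-++ₘ e M TET′ =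
      eqR (Pointwise.refl (Rel∅-refl e)) refl (++⁺ (Pointwise.refl e) TET′)

    Pointwise-upd : ∀ {R R′} i {u u′} → Pointwise (Rel∅ enc E) R R′ → Rel∅ enc E u u′ →
                    Pointwise (Rel∅ enc E) (upd R i u) (upd R′ i u′)
    Pointwise-upd i [] uEu′ = []
    Pointwise-upd zero (_ ∷ RER′) uEu′ = uEu′ ∷ RER′
    Pointwise-upd (suc i) (e ∷ RER′) uEu′ = e ∷ Pointwise-upd i RER′ uEu′

    Pointwise-get : ∀ {R R′} → Pointwise (Rel∅ enc E) R R′ → ∀ i p p′ →
                    E (#⁻¹ (get R i p)) (#⁻¹ (get R′ i p′))
    Pointwise-get (aa e ∷ _) zero p p′ = e
    Pointwise-get (∅∅ ∷ RER′) (suc i) p p′ = Pointwise-get RER′ i p p′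
    Pointwise-get (aa _ ∷ RER′) (suc i) p p′ = Pointwise-get RER′ i p p′

    Pointwise-empty : ∀ {R} m → Pointwise (Rel∅ enc E) R (replicate m nothing) →
                      R ≡ replicate m nothing
    Pointwise-empty zero [] = refl
    Pointwise-empty (suc m) (∅∅ ∷ RE∅) = cong (nothing ∷_) (Pointwise-empty m RE∅)

    componentwise-x : ∀ {K} n → K =⟨ E ⟩ x n → K ≡ x n
    componentwise-x {mk R _ _ []} n (eqR regs refl []) with Pointwise-empty (suc n) regs
    ... | refl = refl

  data _↠[_]_ : Machine A → ℕ → Machine A → Set where
    stop : ∀ {M} → M ↠[ 0 ] M
    step : ∀ {k M M′ N} → M ⟶ M′ → M′ ↠[ k ] N → M ↠[ suc k ] N

  counted : ∀ {M N} → M ↠ N → ∃ λ k → M ↠[ k ] N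
  counted done = 0 , stop
  counted (s ◅ r) with counted r
  ... | k , r′ = suc k , step s r′

  data _≅_ : Machine A → Machine A → Set where
    ≃⇒≅ : ∀ {K L} → K ≃ L → K ≅ L
    componentwise : ∀ {K L} → K =⟨ _≅_ ⟩ L → K ≅ L
    ≅-++ₘ : ∀ {M N T T′} → M ≅ N → Pointwise (_≅_ on #⁻¹) T T′ → (M ++ₘ T) ≅ (N ++ₘ T′)

  ≅-· : ∀ {a a′ b b′} → #⁻¹ a ≅ #⁻¹ a′ → #⁻¹ b ≅ #⁻¹ b′ →
        #⁻¹ (_·_ enc a b) ≅ #⁻¹ (_·_ enc a′ b′)
  ≅-· {a} {a′} {b} {b′} a≅a′ b≅b′ =
    subst₂ _≅_ (sym (Inverse.strictlyInverseʳ enc (#⁻¹ a ++ₘ [ b ])))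
               (sym (Inverse.strictlyInverseʳ enc (#⁻¹ a′ ++ₘ [ b′ ])))
               (≅-++ₘ a≅a′ (b≅b′ ∷ []))

  -- Each step of L is matched by the same instruction in K; only Call hands the
  -- simulation over to the related machines #⁻¹ R_i @ T, with one step fewer to go.
  mutual
    componentwise-↠x : ∀ k {K L} n → K =⟨ _≅_ ⟩ L → L ↠[ k ] x n → K ↠ x n
    componentwise-↠x zero n K=L stop = subst (_↠ x n) (sym (componentwise-x n K=L)) done
    componentwise-↠x (suc k) n (eqR regs refl (e ∷ tape)) (step (h-load _ i P _ _ _) r) =
      h-load _ i P _ _ _ ◅ componentwise-↠x k n (eqR (Pointwise-upd i regs (aa e)) refl tape) r
    componentwise-↠x (suc k) {mk RK _ vK TK} n (eqR regs refl tape)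
                     (step (h-app _ i j l B _ _) r) =
      h-app RK i j l B vK TK ◅
      componentwise-↠x k n (eqR (Pointwise-upd l regs (aa (≅-· (Pointwise-get regs i _ _)
                                                                (Pointwise-get regs j _ _))))
                                refl tape) r
    componentwise-↠x (suc k) {mk RK _ vK TK} n (eqR regs refl tape) (step (h-call _ i v _) r) =
      h-call RK i vK TK ◅ ≅-++ₘ-↠x k n (Pointwise-get regs i vK v) tape r

    ≅-++ₘ-↠x : ∀ k {K L} n → K ≅ L → ∀ {T T′} → Pointwise (_≅_ on #⁻¹) T T′ →
               (L ++ₘ T′) ↠[ k ] x n → (K ++ₘ T) ↠ x n
    ≅-++ₘ-↠x k {L = L} n (≃⇒≅ (K≼L , _)) {T} TT′ r =
      K≼L T n (componentwise-↠x k n (componentwise-++ₘ (≃⇒≅ ≃-refl) L TT′) r)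
    ≅-++ₘ-↠x k n (componentwise (eqR regs prog tape)) TT′ r =
      componentwise-↠x k n (eqR regs prog (++⁺ tape TT′)) r
    ≅-++ₘ-↠x k n (≅-++ₘ {M} {N} {T₀} {T₀′} M≅N T₀T₀′) {T} {T′} TT′ r =
      subst (_↠ x n) (sym (++ₘ-assoc M T₀ T))
        (≅-++ₘ-↠x k n M≅N (++⁺ T₀T₀′ TT′) (subst (_↠[ k ] x n) (++ₘ-assoc N T₀′ T′) r))

  componentwise-≼ : ∀ {K L} → K =⟨ _≃_ ⟩ L → K ≼ L
  componentwise-≼ K=L T n r =
    ≅-++ₘ-↠x (proj₁ (counted r)) n (componentwise (componentwise-map ≃⇒≅ K=L))
             (Pointwise.refl (≃⇒≅ ≃-refl)) (proj₂ (counted r))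

  componentwise-≃ : ∀ {K L} → K =⟨ _≃_ ⟩ L → K ≃ L
  componentwise-≃ K=L = componentwise-≼ K=L , componentwise-≼ (componentwise-sym ≃-sym K=L)

  ≃-upd : ∀ {a b} M i → #⁻¹ a ≃ #⁻¹ b → (M [ i ≔ a ]) ≃ (M [ i ≔ b ])
  ≃-upd M i a≃b =
    componentwise-≃ (eqR (Pointwise-upd i (Pointwise.refl (Rel∅-refl ≃-refl)) (aa a≃b))
                         refl (Pointwise.refl ≃-refl))

  ≃-arg : ∀ {a b} M → #⁻¹ a ≃ #⁻¹ b → (M ++ₘ [ a ]) ≃ (M ++ₘ [ b ])
  ≃-arg M a≃b = componentwise-≃ (componentwise-++ₘ ≃-refl M (a≃b ∷ []))

  -- The pointwise cases are spelled out: through Pointwise.map the recursive calls would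
  -- not be seen to terminate.
  mutual
    ≡𝔸⇒≃ : ∀ {M N} → _≡𝔸_ enc M N → M ≃ N
    ≡𝔸⇒≃ (𝔸-base M↠Z (eqR regs prog tape)) =
      ≃-trans (↠⇒≃ M↠Z) (componentwise-≃ (eqR (≡𝔸⇒≃-registers regs) prog (≡𝔸⇒≃-tape tape)))
    ≡𝔸⇒≃ 𝔸-refl = ≃-refl
    ≡𝔸⇒≃ (𝔸-sym d) = ≃-sym (≡𝔸⇒≃ d)
    ≡𝔸⇒≃ (𝔸-trans d e) = ≃-trans (≡𝔸⇒≃ d) (≡𝔸⇒≃ e)

    ≡𝔸⇒≃-registers : ∀ {R R′} → Pointwise (Rel∅ enc (_≡𝔸_ enc)) R R′ →
                     Pointwise (Rel∅ enc _≃_) R R′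
    ≡𝔸⇒≃-registers [] = []
    ≡𝔸⇒≃-registers (∅∅ ∷ ds) = ∅∅ ∷ ≡𝔸⇒≃-registers ds
    ≡𝔸⇒≃-registers (aa d ∷ ds) = aa (≡𝔸⇒≃ d) ∷ ≡𝔸⇒≃-registers ds

    ≡𝔸⇒≃-tape : ∀ {T T′} → Pointwise (_≡𝔸_ enc on #⁻¹) T T′ → Pointwise (_≃_ on #⁻¹) T T′
    ≡𝔸⇒≃-tape [] = []
    ≡𝔸⇒≃-tape (d ∷ ds) = ≡𝔸⇒≃ d ∷ ≡𝔸⇒≃-tape ds

  mutual
    ≈⇒≃ : ∀ {M α N} → _≈[_]_ enc M α N → M ≃ N
    ≈⇒≃ ≈-refl = ≃-refl
    ≈⇒≃ (≈-sym d) = ≃-sym (≈⇒≃ d)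
    ≈⇒≃ (≈-𝔸 d) = ≡𝔸⇒≃ d
    ≈⇒≃ (≈-stuck M↠stuck N↠stuck f) =
      ≃-stuck M↠stuck N↠stuck (λ a → ≡⇒≃ (proj₂ (proj₂ (f a))))
    ≈⇒≃ (≈-mono _ d) = ≈⇒≃ d

    ∼⇒≃ : ∀ {M α N} → _∼[_]_ enc M α N → M ≃ N
    ∼⇒≃ ∼-refl = ≃-refl
    ∼⇒≃ (∼-sym d) = ≃-sym (∼⇒≃ d)
    ∼⇒≃ (∼-≈ d) = ≈⇒≃ d
    ∼⇒≃ (∼-reg M i d) = ≃-upd M i (∼⇒≃ d)
    ∼⇒≃ (∼-arg M d) = ≃-arg M (∼⇒≃ d)
    ∼⇒≃ (∼-tape T d) = ≃-++ₘ T (∼⇒≃ d)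
    ∼⇒≃ (∼-mono _ d) = ∼⇒≃ d

    ≡⇒≃ : ∀ {M α N} → _≡[_]_ enc M α N → M ≃ N
    ≡⇒≃ ≡-refl = ≃-refl
    ≡⇒≃ (≡-sym d) = ≃-sym (≡⇒≃ d)
    ≡⇒≃ (≡-∼ d) = ∼⇒≃ d
    ≡⇒≃ (≡-reg M i d) = ≃-upd M i (≡⇒≃ d)
    ≡⇒≃ (≡-arg M d) = ≃-arg M (≡⇒≃ d)
    ≡⇒≃ (≡-tape T d) = ≃-++ₘ T (≡⇒≃ d)
    ≡⇒≃ (≡-mono _ d) = ≡⇒≃ d
    ≡⇒≃ (≡-trans d e) = ≃-trans (≡⇒≃ d) (≡⇒≃ e)

proposition5p11 : {A : Set} (countable : A ↔ ℕ) (enc : Machine A ↔ A)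
                  (M N : Machine A) (α : Ord) (n : ℕ) →
                  _≡[_]_ enc M α N → _↠h_ enc N (x n) → _↠h_ enc M (x n)
proposition5p11 countable enc M N α n M≡N N↠x = ≼⇒↠x enc (proj₁ (≡⇒≃ enc M≡N)) N↠x
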